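{- For every integer $n \geq 2$ and every $m \in \mathbb{N}$, there is a $t \in \mathbb{N}$ such that $\chi^*_{DP} (K_{n,m}) \leq n+1-1/t$.
   Context: All graphs are finite and simple; $\mathbb{N}=\{1,2,3,\dots\}$; $K_{n,m}$ is the complete bipartite graph with parts of sizes $n$ and $m$. A cover of a graph $G$ is a pair $\mathcal{H}=(L,H)$ where $H$ is a graph and $L: V(G)\to\mathcal{P}(V(H))$ satisfies: (1) $\{L(u): u\in V(G)\}$ is a partition of $V(H)$; (2) for every $u\in V(G)$, $H[L(u)]$ is complete; (3) if there is an edge of $H$ between $L(u)$ and $L(v)$ then $u=v$ or $uv\in E(G)$; (4) if $uv\in E(G)$, the edges of $H$ between $L(u)$ and $L(v)$ form a matching (possibly empty). The cover is $a$-fold if $|L(u)|=a$ for all $u$. Edges of $H$ joining distinct parts $L(u)\neq L(v)$ are cross-edges; $S\subseteq V(H)$ is quasi-independent if $H[S]$ contains no cross-edges. For $a\ge b$ in $\mathbb{N}$ and an $a$-fold cover $\mathcal{H}$, $G$ is $(\mathcal{H},b)$-colorable if there is a quasi-independent $S\subseteq V(H)$ with $|S\cap L(v)|\ge b$ for every $v\in V(G)$. $G$ is $(a,b)$-DP-colorable if it is $(\mathcal{H},b)$-colorable for every $a$-fold cover $\mathcal{H}$ of $G$. The fractional DP-chromatic number is $\chi_{DP}^*(G)=\inf\{a/b : G \text{ is } (a,b)\text{ -DP-colorable}\}$. -}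

module Defs where

open import Data.Nat using (ℕ; _+_; _*_; _∸_; _≤_; _<_)
open import Data.Fin using (Fin)
open import Data.Fin.Subset using (Subset; _∈_; ∣_∣)
open import Data.Bool using (Bool; true)
open import Data.Sum using (_⊎_; inj₁; inj₂)
open import Data.Product using (Σ; _×_; ∃)
open import Data.Unit using (⊤)
open import Data.Empty using (⊥)
open import Relation.Binary.PropositionalEquality using (_≡_)

record Graph : Set₁ where
  field
    V     : Set
    Adj   : V → V → Set
    sym   : ∀ {u v} → Adj u v → Adj v u
    irr   : ∀ {u} → Adj u u → ⊥

KAdj : (n m : ℕ) → (Fin n ⊎ Fin m) → (Fin n ⊎ Fin m) → Set
KAdj n m (inj₁ _) (inj₂ _) = ⊤
KAdj n m (inj₂ _) (inj₁ _) = ⊤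
KAdj n m (inj₁ _) (inj₁ _) = ⊥
KAdj n m (inj₂ _) (inj₂ _) = ⊥

K : ℕ → ℕ → Graph
K n m = record
  { V = Fin n ⊎ Fin m
  ; Adj = KAdj n m
  ; sym = λ { {inj₁ _} {inj₂ _} _ → _ ; {inj₂ _} {inj₁ _} _ → _
            ; {inj₁ _} {inj₁ _} () ; {inj₂ _} {inj₂ _} () }
  ; irr = λ { {inj₁ _} () ; {inj₂ _} () }
  }

-- An a-fold cover of G. Up to isomorphism, V(H) = V(G) × Fin a with
-- L(u) = {u} × Fin a (each L(u) a clique, which is irrelevant for colourings).
-- The cross-edges are given by a (decidable) relation `cross`:
-- cross u v i j ≡ true  iff (u,i)(v,j) is a cross-edge of H.
record Cover (G : Graph) (a : ℕ) : Set₁ where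
  open Graph G
  field
    cross      : V → V → Fin a → Fin a → Bool
    cross-sym  : ∀ u v i j → cross u v i j ≡ true → cross v u j i ≡ true
    cross-adj  : ∀ u v i j → cross u v i j ≡ true → Adj u v
    cross-match : ∀ u v i j k → cross u v i j ≡ true → cross u v i k ≡ true → j ≡ k

-- G is (H,b)-colourable: a quasi-independent S (given by S v = S ∩ L(v))
-- with |S ∩ L(v)| ≥ b for all v.
HColorable : (G : Graph) {a : ℕ} → Cover G a → ℕ → Set
HColorable G {a} H b =
  Σ (Graph.V G → Subset a) λ S →
    (∀ v → b ≤ ∣ S v ∣) ×
    (∀ u v i j → Cover.cross H u v i j ≡ true → i ∈ S u → j ∈ S v → ⊥)

-- (a,b)-DP-colourable (for a ≥ b, imposed where used).
DPColorable : Graph → ℕ → ℕ → Set₁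
DPColorable G a b = (H : Cover G a) → HColorable G H b

-- χ*_DP(G) ≤ p/q  (q ≥ 1), i.e. inf{a/b : b ≤ a, b ≥ 1, G (a,b)-DP-colourable} ≤ p/q,
-- expressed as: for every rational c/d > p/q some a/b in the set satisfies a/b ≤ c/d.
FracDPAtMost : Graph → ℕ → ℕ → Set₁
FracDPAtMost G p q =
  ∀ c d → 1 ≤ d → p * d < c * q →
    Σ ℕ λ a → Σ ℕ λ b → 1 ≤ b × b ≤ a × DPColorable G a b × a * d ≤ c * b

{-# OPTIONS --safe #-}
module Submission where

open import Defs
open import Data.Nat using (ℕ; _+_; _*_; _∸_; _≤_)
open import Data.Product using (Σ; _×_)

import Data.Nat as ℕ
open import Data.Nat using (_<_; z≤n; s≤s; s≤s⁻¹)
open import Data.Nat.Properties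
  using (≤-refl; ≤-trans; ≤-reflexive; <⇒≤; m≤n⇒m<n∨m≡n; m≤m+n; +-comm; +-assoc; +-suc;
         +-mono-≤; +-monoˡ-≤; +-monoʳ-≤; +-monoˡ-<; +-mono-<-≤; *-mono-≤; *-identityʳ;
         +-∸-assoc; m+n≤o⇒m≤o∸n; module ≤-Reasoning)
open import Data.Fin using (Fin; zero; suc; punchOut; _≟_)
open import Data.Fin.Properties using (any?; all?; ¬∀⟶∃¬; punchOut-injective; <⇒notInjective)
open import Data.Fin.Subset
  using (Subset; inside; outside; _∈_; _∉_; _⊆_; ∣_∣; ⊥; ⊤; ⁅_⁆; _∪_; _-_; ∁; Empty)
open import Data.Fin.Subset.Properties
  using (_∈?_; nonempty?; Empty-unique; ∉⊥; ∈⊤; ⊆⊤; x∈⁅x⁆; ∣⊥∣≡0; ∣⊤∣≡n; ∣⁅x⁆∣≡1;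
         ∪-assoc; ∪-comm; x∈p∪q⁺; x∈p∪q⁻; in⊆in; out⊆; x∈p∧x≢y⇒x∈p-y; x∈p⇒∣p-x∣<∣p∣;
         p⊆q⇒∣p∣≤∣q∣; ∣p∣≤∣x∷p∣; ∣∁p∣≡n∸∣p∣; x∈∁p⇒x∉p)
open import Data.Vec using ([]; _∷_; here; there; tabulate)
open import Data.Vec.Properties using (lookup∘tabulate; []=⇒lookup; lookup⇒[]=)
open import Data.Bool using (Bool; true)
open import Data.Product using (∃; _,_; proj₁; proj₂; map; map₂)
open import Data.Sum using (_⊎_; inj₁; inj₂)
open import Data.Empty using (⊥-elim)
open import Function using (id; _∘_)
open import Function.Definitions using (Injective)
open import Relation.Nullary using (yes; no; contradiction)
open import Relation.Binary.PropositionalEquality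
  using (_≡_; _≢_; refl; sym; trans; cong; cong₂; subst; subst₂)

-- Give every left vertex of K_{n,m} a set of t colours and every right vertex w
-- the colours of L(w) that are not matched to any of these n t colours.  With
-- a ≥ (n + 1) t - 1 colours, at least a - (n t - 1) ≥ t of them remain as soon
-- as, for every w, one of the chosen left colours is unmatched or shares its
-- partner with another one.
-- Fix colour 0 at left vertex 0.  Since the matching between L(1) and L(w) is
-- injective and |L(1)| = |L(w)|, some colour y_w of L(1) is matched to the
-- partner of 0 or is unmatched; as m ≤ t, all the y_w fit into the t colours
-- of left vertex 1.

∣p∪q∣≤∣p∣+∣q∣ : ∀ {n} (p q : Subset n) → ∣ p ∪ q ∣ ≤ ∣ p ∣ + ∣ q ∣
∣p∪q∣≤∣p∣+∣q∣ []            []            = z≤n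
∣p∪q∣≤∣p∣+∣q∣ (inside  ∷ p) (s ∷ q)       =
  s≤s (≤-trans (∣p∪q∣≤∣p∣+∣q∣ p q) (+-monoʳ-≤ ∣ p ∣ (∣p∣≤∣x∷p∣ s q)))
∣p∪q∣≤∣p∣+∣q∣ (outside ∷ p) (inside  ∷ q) =
  ≤-trans (s≤s (∣p∪q∣≤∣p∣+∣q∣ p q)) (≤-reflexive (sym (+-suc ∣ p ∣ ∣ q ∣)))
∣p∪q∣≤∣p∣+∣q∣ (outside ∷ p) (outside ∷ q) = ∣p∪q∣≤∣p∣+∣q∣ p q

subsingleton⇒∣p∣≤1 : ∀ {n} {p : Subset n} → (∀ {x y} → x ∈ p → y ∈ p → x ≡ y) → ∣ p ∣ ≤ 1
subsingleton⇒∣p∣≤1 {n} {p} unique with nonempty? p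
... | yes (x , x∈p) = begin
  ∣ p ∣     ≤⟨ p⊆q⇒∣p∣≤∣q∣ (λ y∈p → subst (_∈ ⁅ x ⁆) (unique x∈p y∈p) (x∈⁅x⁆ x)) ⟩
  ∣ ⁅ x ⁆ ∣ ≡⟨ ∣⁅x⁆∣≡1 x ⟩
  1         ∎
  where open ≤-Reasoning
... | no p-empty = ≤-trans (≤-reflexive (trans (cong ∣_∣ (Empty-unique p-empty)) (∣⊥∣≡0 n))) z≤n

⊆-extend : ∀ {n t} (p : Subset n) → ∣ p ∣ ≤ t → t ≤ n → ∃ λ q → p ⊆ q × ∣ q ∣ ≡ t
⊆-extend []            z≤n z≤n = [] , id , refl
⊆-extend (inside  ∷ p) (s≤s ∣p∣≤t) (s≤s t≤n) =
  map (inside ∷_) (map in⊆in (cong ℕ.suc)) (⊆-extend p ∣p∣≤t t≤n)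
⊆-extend {ℕ.suc n} (outside ∷ p) ∣p∣≤t t≤1+n with m≤n⇒m<n∨m≡n t≤1+n
... | inj₁ t<1+n = map (outside ∷_) (map out⊆ id) (⊆-extend p ∣p∣≤t (s≤s⁻¹ t<1+n))
... | inj₂ t≡1+n = ⊤ , ⊆⊤ , trans (∣⊤∣≡n (ℕ.suc n)) (sym t≡1+n)

∈-tabulate⁺ : ∀ {n} {f : Fin n → Bool} {x} → f x ≡ true → x ∈ tabulate f
∈-tabulate⁺ {f = f} {x} fx≡true = lookup⇒[]= x _ (trans (lookup∘tabulate f x) fx≡true)

∈-tabulate⁻ : ∀ {n} {f : Fin n → Bool} {x} → x ∈ tabulate f → f x ≡ true
∈-tabulate⁻ {f = f} {x} x∈ = trans (sym (lookup∘tabulate f x)) ([]=⇒lookup x∈)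

infix 9 _⟦_⟧

_⟦_⟧ : ∀ {m n} → (Fin m → Subset n) → Subset m → Subset n
R ⟦ []          ⟧ = ⊥
R ⟦ inside  ∷ p ⟧ = R zero ∪ (R ∘ suc) ⟦ p ⟧
R ⟦ outside ∷ p ⟧ = (R ∘ suc) ⟦ p ⟧

∈⟦⟧⁺ : ∀ {m n} (R : Fin m → Subset n) {p x y} → x ∈ p → y ∈ R x → y ∈ R ⟦ p ⟧
∈⟦⟧⁺ R {p = inside  ∷ p} here        y∈Rx = x∈p∪q⁺ (inj₁ y∈Rx)
∈⟦⟧⁺ R {p = inside  ∷ p} (there x∈p) y∈Rx = x∈p∪q⁺ (inj₂ (∈⟦⟧⁺ (R ∘ suc) x∈p y∈Rx))
∈⟦⟧⁺ R {p = outside ∷ p} (there x∈p) y∈Rx = ∈⟦⟧⁺ (R ∘ suc) x∈p y∈Rx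

∈⟦⟧⁻ : ∀ {m n} {R : Fin m → Subset n} {p y} → y ∈ R ⟦ p ⟧ → ∃ λ x → x ∈ p × y ∈ R x
∈⟦⟧⁻ {p = []} y∈⊥ = contradiction y∈⊥ ∉⊥
∈⟦⟧⁻ {R = R} {p = inside ∷ p} y∈R⟦p⟧ with x∈p∪q⁻ (R zero) ((R ∘ suc) ⟦ p ⟧) y∈R⟦p⟧
... | inj₁ y∈R0 = zero , here , y∈R0
... | inj₂ y∈R⟦p⟧′ = map suc (map there id) (∈⟦⟧⁻ y∈R⟦p⟧′)
∈⟦⟧⁻ {p = outside ∷ p} y∈R⟦p⟧ = map suc (map there id) (∈⟦⟧⁻ y∈R⟦p⟧)

∣R⟦p⟧∣≤∣p∣*c : ∀ {m n c} (R : Fin m → Subset n) → (∀ x → ∣ R x ∣ ≤ c) → ∀ p →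
               ∣ R ⟦ p ⟧ ∣ ≤ ∣ p ∣ * c
∣R⟦p⟧∣≤∣p∣*c {n = n} R ∣R∣≤c []            = ≤-reflexive (∣⊥∣≡0 n)
∣R⟦p⟧∣≤∣p∣*c {c = c} R ∣R∣≤c (inside  ∷ p) = begin
  ∣ R zero ∪ (R ∘ suc) ⟦ p ⟧ ∣       ≤⟨ ∣p∪q∣≤∣p∣+∣q∣ (R zero) _ ⟩
  ∣ R zero ∣ + ∣ (R ∘ suc) ⟦ p ⟧ ∣   ≤⟨ +-mono-≤ (∣R∣≤c zero)
                                                 (∣R⟦p⟧∣≤∣p∣*c (R ∘ suc) (∣R∣≤c ∘ suc) p) ⟩
  c + ∣ p ∣ * c                      ∎
  where open ≤-Reasoning
∣R⟦p⟧∣≤∣p∣*c R ∣R∣≤c (outside ∷ p) = ∣R⟦p⟧∣≤∣p∣*c (R ∘ suc) (∣R∣≤c ∘ suc) p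

∣R⟦p⟧∣≤∣p∣ : ∀ {m n} (R : Fin m → Subset n) → (∀ x → ∣ R x ∣ ≤ 1) → ∀ p → ∣ R ⟦ p ⟧ ∣ ≤ ∣ p ∣
∣R⟦p⟧∣≤∣p∣ R ∣R∣≤1 p = ≤-trans (∣R⟦p⟧∣≤∣p∣*c R ∣R∣≤1 p) (≤-reflexive (*-identityʳ ∣ p ∣))

R⟦p⟧∪q⊆R⟦p-x⟧∪q : ∀ {m n} {R : Fin m → Subset n} {p q x} →
                   R x ⊆ q → R ⟦ p ⟧ ∪ q ⊆ R ⟦ p - x ⟧ ∪ q
R⟦p⟧∪q⊆R⟦p-x⟧∪q {R = R} {p} {q} {x} Rx⊆q {y} y∈ with x∈p∪q⁻ (R ⟦ p ⟧) q y∈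
... | inj₂ y∈q = x∈p∪q⁺ (inj₂ y∈q)
... | inj₁ y∈R⟦p⟧ with ∈⟦⟧⁻ {R = R} {p = p} y∈R⟦p⟧
...   | x′ , x′∈p , y∈Rx′ with x′ ≟ x
...     | yes refl = x∈p∪q⁺ (inj₂ (Rx⊆q y∈Rx′))
...     | no x′≢x  = x∈p∪q⁺ (inj₁ (∈⟦⟧⁺ R (x∈p∧x≢y⇒x∈p-y x′∈p x′≢x) y∈Rx′))

∣R⟦p⟧∪q∣<∣p∣+∣q∣ : ∀ {m n} {R : Fin m → Subset n} {p q x} → (∀ x → ∣ R x ∣ ≤ 1) →
                   x ∈ p → R x ⊆ q → ∣ R ⟦ p ⟧ ∪ q ∣ < ∣ p ∣ + ∣ q ∣
∣R⟦p⟧∪q∣<∣p∣+∣q∣ {R = R} {p} {q} {x} ∣R∣≤1 x∈p Rx⊆q = begin-strict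
  ∣ R ⟦ p ⟧ ∪ q ∣        ≤⟨ p⊆q⇒∣p∣≤∣q∣ (R⟦p⟧∪q⊆R⟦p-x⟧∪q {p = p} Rx⊆q) ⟩
  ∣ R ⟦ p - x ⟧ ∪ q ∣    ≤⟨ ∣p∪q∣≤∣p∣+∣q∣ (R ⟦ p - x ⟧) q ⟩
  ∣ R ⟦ p - x ⟧ ∣ + ∣ q ∣ ≤⟨ +-monoˡ-≤ ∣ q ∣ (∣R⟦p⟧∣≤∣p∣ R ∣R∣≤1 (p - x)) ⟩
  ∣ p - x ∣ + ∣ q ∣      <⟨ +-monoˡ-< ∣ q ∣ (x∈p⇒∣p-x∣<∣p∣ x∈p) ⟩
  ∣ p ∣ + ∣ q ∣          ∎
  where open ≤-Reasoning

∣R⟦p⟧∪S⟦q⟧∣<∣p∣+∣q∣ : ∀ {m n} {R S : Fin m → Subset n} {p q x y} →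
                      (∀ x → ∣ R x ∣ ≤ 1) → (∀ y → ∣ S y ∣ ≤ 1) → x ∈ p → y ∈ q →
                      R x ⊆ S y ⊎ S y ⊆ R x → ∣ R ⟦ p ⟧ ∪ S ⟦ q ⟧ ∣ < ∣ p ∣ + ∣ q ∣
∣R⟦p⟧∪S⟦q⟧∣<∣p∣+∣q∣ {R = R} {S} {p} {q} ∣R∣≤1 ∣S∣≤1 x∈p y∈q (inj₁ Rx⊆Sy) = begin-strict
  ∣ R ⟦ p ⟧ ∪ S ⟦ q ⟧ ∣ <⟨ ∣R⟦p⟧∪q∣<∣p∣+∣q∣ ∣R∣≤1 x∈p (∈⟦⟧⁺ S y∈q ∘ Rx⊆Sy) ⟩
  ∣ p ∣ + ∣ S ⟦ q ⟧ ∣   ≤⟨ +-monoʳ-≤ ∣ p ∣ (∣R⟦p⟧∣≤∣p∣ S ∣S∣≤1 q) ⟩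
  ∣ p ∣ + ∣ q ∣         ∎
  where open ≤-Reasoning
∣R⟦p⟧∪S⟦q⟧∣<∣p∣+∣q∣ {R = R} {S} {p} {q} ∣R∣≤1 ∣S∣≤1 x∈p y∈q (inj₂ Sy⊆Rx) =
  subst₂ _<_ (cong ∣_∣ (∪-comm (S ⟦ q ⟧) (R ⟦ p ⟧))) (+-comm ∣ q ∣ ∣ p ∣)
    (∣R⟦p⟧∪S⟦q⟧∣<∣p∣+∣q∣ ∣S∣≤1 ∣R∣≤1 y∈q x∈p (inj₁ Sy⊆Rx))

record IsMatching {m n} (R : Fin m → Subset n) : Set where
  field
    functional : ∀ {x y z} → y ∈ R x → z ∈ R x → y ≡ z
    injective  : ∀ {x y z} → z ∈ R x → z ∈ R y → x ≡ y

  ∣R∣≤1 : ∀ x → ∣ R x ∣ ≤ 1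
  ∣R∣≤1 x = subsingleton⇒∣p∣≤1 functional

open IsMatching

matched-or-unmatched : ∀ {n} {R : Fin n → Subset n} → IsMatching R →
                       ∀ c → ∃ λ y → c ∈ R y ⊎ Empty (R y)
matched-or-unmatched {ℕ.suc n} {R} M c
  with any? (λ y → c ∈? R y) | all? (λ y → nonempty? (R y))
... | yes (y , c∈Ry) | _        = y , inj₁ c∈Ry
... | no _          | no ¬total = map₂ inj₂ (¬∀⟶∃¬ _ _ (λ y → nonempty? (R y)) ¬total)
... | no c∉R        | yes total = ⊥-elim (<⇒notInjective ≤-refl f-injective)
  where
  c≢partner : ∀ y → c ≢ proj₁ (total y)
  c≢partner y refl = c∉R (y , proj₂ (total y))

  -- A total R would squeeze Fin (1 + n) injectively into the n colours other than c.
  f : Fin (ℕ.suc n) → Fin n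
  f y = punchOut (c≢partner y)

  f-injective : Injective _≡_ _≡_ f
  f-injective {x} {y} fx≡fy = injective M (proj₂ (total x))
    (subst (_∈ R y) (sym (punchOut-injective (c≢partner x) (c≢partner y) fx≡fy)) (proj₂ (total y)))

comparable-partner : ∀ {k n} {R : Fin k → Subset (ℕ.suc n)} {S : Fin (ℕ.suc n) → Subset (ℕ.suc n)} →
                     IsMatching R → IsMatching S → ∀ x → ∃ λ y → R x ⊆ S y ⊎ S y ⊆ R x
comparable-partner {R = R} {S} MR MS x with nonempty? (R x)
... | no Rx-empty = zero , inj₁ (λ z∈Rx → contradiction (_ , z∈Rx) Rx-empty)
... | yes (c , c∈Rx) with matched-or-unmatched MS c
...   | y , inj₁ c∈Sy     = y , inj₁ (λ z∈Rx → subst (_∈ S y) (functional MR c∈Rx z∈Rx) c∈Sy)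
...   | y , inj₂ Sy-empty = y , inj₂ (λ z∈Sy → contradiction (_ , z∈Sy) Sy-empty)

module _ {G : Graph} {a : ℕ} (H : Cover G a) where
  open Graph G using (V)
  open Cover H

  crossing : V → V → Fin a → Subset a
  crossing u v i = tabulate (cross u v i)

  crossing-isMatching : ∀ u v → IsMatching (crossing u v)
  crossing-isMatching u v = record
    { functional = λ j∈ k∈ → cross-match u v _ _ _ (∈-tabulate⁻ j∈) (∈-tabulate⁻ k∈)
    ; injective  = λ k∈ k∈′ →
        cross-match v u _ _ _ (cross-sym u v _ _ (∈-tabulate⁻ k∈))
                              (cross-sym u v _ _ (∈-tabulate⁻ k∈′))
    }

t+n*t≤1+a⇒t≤a : ∀ {n t a} → 1 ≤ n → 1 ≤ t → t + n * t ≤ ℕ.suc a → t ≤ a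
t+n*t≤1+a⇒t≤a {n} {t} {a} 1≤n 1≤t t+nt≤1+a = s≤s⁻¹ (begin
  ℕ.suc t   ≡⟨ +-comm 1 t ⟩
  t + 1     ≤⟨ +-monoʳ-≤ t (*-mono-≤ 1≤n 1≤t) ⟩
  t + n * t ≤⟨ t+nt≤1+a ⟩
  ℕ.suc a   ∎)
  where open ≤-Reasoning

module Colouring {n m a t : ℕ} (1≤t : 1 ≤ t) (m≤t : m ≤ t)
                 (t+nt≤1+a : t + (2 + n) * t ≤ ℕ.suc (ℕ.suc a))
                 (H : Cover (K (2 + n) m) (ℕ.suc a)) where

  open Cover H

  N : Fin (2 + n) → Fin m → Fin (ℕ.suc a) → Subset (ℕ.suc a)
  N u w = crossing H (inj₁ u) (inj₂ w)

  N-isMatching : ∀ u w → IsMatching (N u w)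
  N-isMatching u w = crossing-isMatching H (inj₁ u) (inj₂ w)

  comparable : ∀ w → ∃ λ y → N zero w zero ⊆ N (suc zero) w y ⊎ N (suc zero) w y ⊆ N zero w zero
  comparable w = comparable-partner (N-isMatching zero w) (N-isMatching (suc zero) w) zero

  partner : Fin m → Fin (ℕ.suc a)
  partner w = proj₁ (comparable w)

  seed : Fin (2 + n) → Subset (ℕ.suc a)
  seed zero          = ⁅ zero ⁆
  seed (suc zero)    = (λ w → ⁅ partner w ⁆) ⟦ ⊤ ⟧
  seed (suc (suc _)) = ⊥

  ∣seed∣≤t : ∀ u → ∣ seed u ∣ ≤ t
  ∣seed∣≤t zero          = ≤-trans (≤-reflexive (∣⁅x⁆∣≡1 {n = ℕ.suc a} zero)) 1≤t
  ∣seed∣≤t (suc zero)    =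
    ≤-trans (∣R⟦p⟧∣≤∣p∣ _ (λ w → ≤-reflexive (∣⁅x⁆∣≡1 (partner w))) ⊤)
            (≤-trans (≤-reflexive (∣⊤∣≡n m)) m≤t)
  ∣seed∣≤t (suc (suc _)) = ≤-trans (≤-reflexive (∣⊥∣≡0 (ℕ.suc a))) z≤n

  palette : ∀ u → ∃ λ q → seed u ⊆ q × ∣ q ∣ ≡ t
  palette u = ⊆-extend (seed u) (∣seed∣≤t u) (t+n*t≤1+a⇒t≤a {2 + n} (s≤s z≤n) 1≤t t+nt≤1+a)

  Q : Fin (2 + n) → Subset (ℕ.suc a)
  Q u = proj₁ (palette u)

  seed⊆Q : ∀ u → seed u ⊆ Q u
  seed⊆Q u = proj₁ (proj₂ (palette u))

  ∣Q∣≡t : ∀ u → ∣ Q u ∣ ≡ t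
  ∣Q∣≡t u = proj₂ (proj₂ (palette u))

  blocked : Fin m → Subset (ℕ.suc a)
  blocked w = (λ u → N u w ⟦ Q u ⟧) ⟦ ⊤ ⟧

  ∣blocked∣<[2+n]t : ∀ w → ∣ blocked w ∣ < (2 + n) * t
  ∣blocked∣<[2+n]t w = begin-strict
    ∣ A ∪ (B ∪ rest) ∣   ≡⟨ cong ∣_∣ (sym (∪-assoc A B rest)) ⟩
    ∣ (A ∪ B) ∪ rest ∣   ≤⟨ ∣p∪q∣≤∣p∣+∣q∣ (A ∪ B) rest ⟩
    ∣ A ∪ B ∣ + ∣ rest ∣ <⟨ +-mono-<-≤ ∣A∪B∣<t+t ∣rest∣≤nt ⟩
    (t + t) + n * t      ≡⟨ +-assoc t t (n * t) ⟩
    (2 + n) * t          ∎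
    where
    open ≤-Reasoning
    A B rest : Subset (ℕ.suc a)
    A    = N zero w ⟦ Q zero ⟧
    B    = N (suc zero) w ⟦ Q (suc zero) ⟧
    rest = (λ u → N (suc (suc u)) w ⟦ Q (suc (suc u)) ⟧) ⟦ ⊤ ⟧

    ∣A∪B∣<t+t : ∣ A ∪ B ∣ < t + t
    ∣A∪B∣<t+t = subst (∣ A ∪ B ∣ <_) (cong₂ _+_ (∣Q∣≡t zero) (∣Q∣≡t (suc zero)))
      (∣R⟦p⟧∪S⟦q⟧∣<∣p∣+∣q∣ (∣R∣≤1 (N-isMatching zero w)) (∣R∣≤1 (N-isMatching (suc zero) w))
        (seed⊆Q zero (x∈⁅x⁆ zero))
        (seed⊆Q (suc zero) (∈⟦⟧⁺ (⁅_⁆ ∘ partner) ∈⊤ (x∈⁅x⁆ (partner w))))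
        (proj₂ (comparable w)))

    ∣rest∣≤nt : ∣ rest ∣ ≤ n * t
    ∣rest∣≤nt = ≤-trans
      (∣R⟦p⟧∣≤∣p∣*c _ (λ u → ≤-trans (∣R⟦p⟧∣≤∣p∣ _ (∣R∣≤1 (N-isMatching (suc (suc u)) w))
                                                   (Q (suc (suc u))))
                                    (≤-reflexive (∣Q∣≡t (suc (suc u))))) ⊤)
      (≤-reflexive (cong (_* t) (∣⊤∣≡n n)))

  S : Fin (2 + n) ⊎ Fin m → Subset (ℕ.suc a)
  S (inj₁ u) = Q u
  S (inj₂ w) = ∁ (blocked w)

  t≤∣S∣ : ∀ v → t ≤ ∣ S v ∣
  t≤∣S∣ (inj₁ u) = ≤-reflexive (sym (∣Q∣≡t u))
  t≤∣S∣ (inj₂ w) = subst (t ≤_) (sym (∣∁p∣≡n∸∣p∣ (blocked w))) (m+n≤o⇒m≤o∸n t (s≤s⁻¹ (begin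
    ℕ.suc (t + ∣ blocked w ∣) ≡⟨ +-suc t _ ⟨
    t + ℕ.suc ∣ blocked w ∣   ≤⟨ +-monoʳ-≤ t (∣blocked∣<[2+n]t w) ⟩
    t + (2 + n) * t           ≤⟨ t+nt≤1+a ⟩
    ℕ.suc (ℕ.suc a)           ∎)))
    where open ≤-Reasoning

  S-independent : ∀ u v i j → cross u v i j ≡ true → i ∈ S u → j ∉ S v
  S-independent (inj₁ _) (inj₁ _) i j e _ _ = cross-adj _ _ i j e
  S-independent (inj₂ _) (inj₂ _) i j e _ _ = cross-adj _ _ i j e
  S-independent (inj₁ u) (inj₂ w) i j e i∈Q j∈S =
    x∈∁p⇒x∉p j∈S (∈⟦⟧⁺ (λ u → N u w ⟦ Q u ⟧) {x = u} ∈⊤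
                   (∈⟦⟧⁺ (N u w) i∈Q (∈-tabulate⁺ {f = cross _ _ i} e)))
  S-independent (inj₂ w) (inj₁ u) i j e i∈S j∈Q =
    S-independent (inj₁ u) (inj₂ w) j i (cross-sym _ _ i j e) j∈Q i∈S

  colouring : HColorable (K (2 + n) m) H t
  colouring = S , t≤∣S∣ , S-independent

K-DPColorable : ∀ {n m a t} → 2 ≤ n → 1 ≤ t → m ≤ t → t + n * t ≤ ℕ.suc a →
                DPColorable (K n m) a t
K-DPColorable {a = ℕ.zero} 2≤n 1≤t _ t+nt≤1
  with ≤-trans 1≤t (t+n*t≤1+a⇒t≤a (≤-trans (s≤s z≤n) 2≤n) 1≤t t+nt≤1)
... | ()
K-DPColorable {a = ℕ.suc a} (s≤s (s≤s z≤n)) 1≤t m≤t t+nt≤1+a =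
  Colouring.colouring 1≤t m≤t t+nt≤1+a

corollary7 : ∀ (n m : ℕ) → 2 ≤ n → 1 ≤ m →
    Σ ℕ λ t → 1 ≤ t × FracDPAtMost (K n m) ((n + 1) * t ∸ 1) t
corollary7 n m 2≤n 1≤m = m , 1≤m , λ c d _ pd<cm →
  a , m , 1≤m , m≤a , K-DPColorable 2≤n 1≤m ≤-refl m+nm≤1+a , <⇒≤ pd<cm
  where
  a : ℕ
  a = (n + 1) * m ∸ 1

  m+nm≡[n+1]m : m + n * m ≡ (n + 1) * m
  m+nm≡[n+1]m = cong (_* m) (+-comm 1 n)

  m+nm≤1+a : m + n * m ≤ ℕ.suc a
  m+nm≤1+a = ≤-reflexive (trans m+nm≡[n+1]m
    (+-∸-assoc 1 (subst (1 ≤_) m+nm≡[n+1]m (≤-trans 1≤m (m≤m+n m (n * m))))))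

  m≤a : m ≤ a
  m≤a = t+n*t≤1+a⇒t≤a (≤-trans (s≤s z≤n) 2≤n) 1≤m m+nm≤1+a
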